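{- Let $G$ be a graph and let $C = v - u - u_1 - u_2 - \dots - u' - v$ be a cycle in $G$ with at least $5$ vertices such that the path $P = u - u_1 - u_2 - \dots - u'$ (i.e., $C$ with $v$ removed) is an induced path in $G$. Then $G$ contains an induced cycle with at least $4$ vertices or an induced diamond.
   Context: A diamond is the graph on vertices $u_1,u_2,u_3,u_4$ in which $u_1,u_2,u_3$ form a triangle and $u_4$ is adjacent exactly to $u_1$ and $u_2$. -}

module Defs where

open import Data.Nat using (ℕ; suc; _≤_)
open import Data.Fin using (Fin; toℕ)
open import Data.Product using (Σ; _×_; ∃-syntax)
open import Data.Sum using (_⊎_)
open import Relation.Binary.PropositionalEquality using (_≡_; _≢_)
open import Relation.Nullary using (¬_; Dec)
open import Function.Definitions using (Injective)

record Graph (n : ℕ) : Set₁ where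
  field
    Adj   : Fin n → Fin n → Set
    sym   : ∀ {x y} → Adj x y → Adj y x
    irrefl : ∀ {x} → ¬ Adj x x
    dec   : ∀ x y → Dec (Adj x y)
open Graph public

PathStep : ∀ {m} → Fin m → Fin m → Set
PathStep i j = suc (toℕ i) ≡ toℕ j

CycStep : ∀ {k} → Fin k → Fin k → Set
CycStep {k} i j = suc (toℕ i) ≡ toℕ j ⊎ (suc (toℕ i) ≡ k × toℕ j ≡ 0)

IsPath : ∀ {n m} → Graph n → (Fin m → Fin n) → Set
IsPath G p = Injective _≡_ _≡_ p × (∀ i j → PathStep i j → Adj G (p i) (p j))

IsInducedPath : ∀ {n m} → Graph n → (Fin m → Fin n) → Set
IsInducedPath G p = IsPath G p ×
  (∀ i j → Adj G (p i) (p j) → PathStep i j ⊎ PathStep j i)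

IsCycle : ∀ {n k} → Graph n → (Fin k → Fin n) → Set
IsCycle {k = k} G c = 3 ≤ k × Injective _≡_ _≡_ c ×
  (∀ i j → CycStep i j → Adj G (c i) (c j))

IsInducedCycle : ∀ {n k} → Graph n → (Fin k → Fin n) → Set
IsInducedCycle G c = IsCycle G c ×
  (∀ i j → Adj G (c i) (c j) → CycStep i j ⊎ CycStep j i)

HasInducedHole : ∀ {n} → Graph n → Set
HasInducedHole {n} G = Σ ℕ λ k → Σ (Fin k → Fin n) λ c → 4 ≤ k × IsInducedCycle G c

IsInducedDiamond : ∀ {n} → Graph n → Fin n → Fin n → Fin n → Fin n → Set
IsInducedDiamond G u₁ u₂ u₃ u₄ =
  u₁ ≢ u₂ × u₁ ≢ u₃ × u₁ ≢ u₄ × u₂ ≢ u₃ × u₂ ≢ u₄ × u₃ ≢ u₄ ×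
  Adj G u₁ u₂ × Adj G u₁ u₃ × Adj G u₂ u₃ ×
  Adj G u₄ u₁ × Adj G u₄ u₂ × ¬ Adj G u₄ u₃

HasInducedDiamond : ∀ {n} → Graph n → Set
HasInducedDiamond G = ∃[ a ] ∃[ b ] ∃[ c ] ∃[ d ] IsInducedDiamond G a b c d

-- Write C as v, p₀, …, pₗ.  If v is adjacent to p₀, p₁ and p₂, then v, p₁, p₀, p₂ is an
-- induced diamond, p₀p₂ not being an edge because P is induced.  Otherwise v ~ pᵢ and
-- v ≁ pᵢ₊₁ for some i ∈ {0, 1}; let pⱼ be the first neighbour of v after pᵢ (one exists,
-- since v ~ pₗ).  In the cycle v, pᵢ, …, pⱼ a chord could only come from v, which has no
-- neighbour strictly between pᵢ and pⱼ, so it is an induced cycle of length j − i + 2 ≥ 4.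

module Submission where

open import Defs
open import Data.Nat using (ℕ; suc; _≤_; _+_; z≤n; s≤s)
open import Data.Nat.Properties using (suc-injective; +-suc; +-cancelˡ-≡)
open import Data.Fin using (Fin; zero; suc; toℕ; fromℕ; inject₁; inject≤)
open import Data.Fin.Properties
  using (toℕ-injective; toℕ-fromℕ; toℕ-inject≤; toℕ-inject₁; toℕ-inject; toℕ<n; ¬∀⟶∃¬-smallest)
open import Data.Fin.Relation.Unary.Top using (view; ‵fromℕ; ‵inject₁)
open import Data.Sum using (_⊎_; inj₁; inj₂; swap)
open import Data.Product using (_,_)
open import Data.Empty using (⊥-elim)
open import Function using (_∘_)
open import Relation.Nullary using (¬_; yes; no)
open import Relation.Nullary.Decidable using (¬?; decidable-stable)
open import Relation.Binary.PropositionalEquality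
  using (_≡_; _≢_; refl; trans; cong; subst; module ≡-Reasoning)
  renaming (sym to ≡-sym)
open import Data.Vec.Functional using (_∷_)

module _ {n} (G : Graph n) where

  isInducedPath-shift : ∀ {m k} {p : Fin m → Fin n} (i : ℕ) (f : Fin k → Fin m) →
    (∀ t → toℕ (f t) ≡ i + toℕ t) → IsInducedPath G p → IsInducedPath G (p ∘ f)
  isInducedPath-shift {p = p} i f f-shift ((p-inj , p-edge) , p-induced) =
    (injective , λ s t → p-edge (f s) (f t) ∘ step⇒) , induced
    where
    step⇒ : ∀ {s t} → PathStep s t → PathStep (f s) (f t)
    step⇒ {s} {t} s→t = begin
      suc (toℕ (f s)) ≡⟨ cong suc (f-shift s) ⟩
      suc (i + toℕ s) ≡⟨ ≡-sym (+-suc i (toℕ s)) ⟩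
      i + suc (toℕ s) ≡⟨ cong (i +_) s→t ⟩
      i + toℕ t       ≡⟨ ≡-sym (f-shift t) ⟩
      toℕ (f t)       ∎
      where open ≡-Reasoning

    step⇐ : ∀ {s t} → PathStep (f s) (f t) → PathStep s t
    step⇐ {s} {t} fs→ft = +-cancelˡ-≡ i _ _ (begin
      i + suc (toℕ s) ≡⟨ +-suc i (toℕ s) ⟩
      suc (i + toℕ s) ≡⟨ cong suc (≡-sym (f-shift s)) ⟩
      suc (toℕ (f s)) ≡⟨ fs→ft ⟩
      toℕ (f t)       ≡⟨ f-shift t ⟩
      i + toℕ t       ∎)
      where open ≡-Reasoning

    injective : ∀ {s t} → p (f s) ≡ p (f t) → s ≡ t
    injective {s} {t} eq = toℕ-injective (+-cancelˡ-≡ i _ _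
      (trans (≡-sym (f-shift s)) (trans (cong toℕ (p-inj eq)) (f-shift t))))

    induced : ∀ s t → Adj G (p (f s)) (p (f t)) → PathStep s t ⊎ PathStep t s
    induced s t adj with p-induced (f s) (f t) adj
    ... | inj₁ fs→ft = inj₁ (step⇐ fs→ft)
    ... | inj₂ ft→fs = inj₂ (step⇐ ft→fs)

  cone-isInducedCycle : ∀ {L v} {q : Fin (suc (suc L)) → Fin n} →
    IsInducedPath G q → (∀ t → v ≢ q t) →
    Adj G v (q zero) → Adj G v (q (fromℕ (suc L))) → (∀ t → ¬ Adj G v (q (suc (inject₁ t)))) →
    IsInducedCycle G (v ∷ q)
  cone-isInducedCycle {L} {v} {q} ((q-inj , q-edge) , q-induced) v∉q v~first v~last v≁inner =
    (s≤s (s≤s (s≤s z≤n)) , injective , edge) , induced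
    where
    injective : ∀ {s t} → (v ∷ q) s ≡ (v ∷ q) t → s ≡ t
    injective {zero}  {zero}  _  = refl
    injective {zero}  {suc t} eq = ⊥-elim (v∉q t eq)
    injective {suc s} {zero}  eq = ⊥-elim (v∉q s (≡-sym eq))
    injective {suc s} {suc t} eq = cong suc (q-inj eq)

    last-index : ∀ {t : Fin (suc (suc L))} → suc (suc (toℕ t)) ≡ suc (suc (suc L)) → t ≡ fromℕ (suc L)
    last-index eq = toℕ-injective (trans (suc-injective (suc-injective eq)) (≡-sym (toℕ-fromℕ (suc L))))

    edge : ∀ s t → CycStep s t → Adj G ((v ∷ q) s) ((v ∷ q) t)
    edge zero    zero          (inj₁ ())
    edge zero    zero          (inj₂ (() , _))
    edge zero    (suc zero)    (inj₁ refl)     = v~first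
    edge zero    (suc (suc _)) (inj₁ ())
    edge (suc s) zero          (inj₂ (eq , _)) = sym G (subst (Adj G v ∘ q) (≡-sym (last-index eq)) v~last)
    edge (suc s) (suc t)       (inj₁ s→t)      = q-edge s t (suc-injective s→t)

    apex : ∀ t → Adj G v (q t) → CycStep {suc (suc (suc L))} zero (suc t) ⊎ CycStep (suc t) zero
    apex zero    _ = inj₁ (inj₁ refl)
    apex (suc t) v~qₜ with view t
    ... | ‵fromℕ     = inj₂ (inj₂ (cong (3 +_) (toℕ-fromℕ L) , refl))
    ... | ‵inject₁ j = ⊥-elim (v≁inner j v~qₜ)

    induced : ∀ s t → Adj G ((v ∷ q) s) ((v ∷ q) t) → CycStep s t ⊎ CycStep t s
    induced zero    zero    v~v = ⊥-elim (irrefl G v~v)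
    induced zero    (suc t) v~qₜ = apex t v~qₜ
    induced (suc s) zero    qₛ~v = swap (apex s (sym G qₛ~v))
    induced (suc s) (suc t) qₛ~qₜ with q-induced s t qₛ~qₜ
    ... | inj₁ s→t = inj₁ (inj₁ (cong suc s→t))
    ... | inj₂ t→s = inj₂ (inj₁ (cong suc t→s))

  hasInducedHole-gap : ∀ {L v} {q : Fin (suc (suc L)) → Fin n} →
    IsInducedPath G q → (∀ t → v ≢ q t) →
    Adj G v (q zero) → ¬ Adj G v (q (suc zero)) → Adj G v (q (fromℕ (suc L))) →
    HasInducedHole G
  hasInducedHole-gap {L} {v} {q} q-ind v∉q v~first v≁second v~last
    with ¬∀⟶∃¬-smallest (suc L) (λ t → ¬ Adj G v (q (suc t))) (λ t → ¬? (dec G v (q (suc t))))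
                        (λ v≁all → v≁all (fromℕ L) v~last)
  ... | zero  , ¬v≁second , _ = ⊥-elim (¬v≁second v≁second)
  ... | suc j , ¬v≁next , v≁before =
    4 + toℕ j , v ∷ q ∘ prefix , s≤s (s≤s (s≤s (s≤s z≤n))) ,
    cone-isInducedCycle (isInducedPath-shift 0 prefix (λ s → toℕ-inject≤ s j+3≤L+2) q-ind)
      (v∉q ∘ prefix) v~first v~end v≁inner
    where
    j+3≤L+2 : 3 + toℕ j ≤ 2 + L
    j+3≤L+2 = s≤s (s≤s (toℕ<n j))

    prefix : Fin (3 + toℕ j) → Fin (2 + L)
    prefix s = inject≤ s j+3≤L+2

    prefix-≡ : ∀ {s t} → toℕ s ≡ toℕ t → prefix s ≡ t
    prefix-≡ {s} eq = toℕ-injective (trans (toℕ-inject≤ s j+3≤L+2) eq)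

    v~end : Adj G v (q (prefix (fromℕ (2 + toℕ j))))
    v~end = subst (Adj G v ∘ q) (≡-sym (prefix-≡ (toℕ-fromℕ (2 + toℕ j))))
      (decidable-stable (dec G v _) ¬v≁next)

    v≁inner : ∀ s → ¬ Adj G v (q (prefix (suc (inject₁ s))))
    v≁inner s = subst (λ t → ¬ Adj G v (q t))
      (≡-sym (prefix-≡ (cong (1 +_) (trans (toℕ-inject₁ s) (≡-sym (toℕ-inject s))))))
      (v≁before s)

  hasInducedDiamond-fan : ∀ {k v} {p : Fin (3 + k) → Fin n} →
    IsInducedPath G p → (∀ t → v ≢ p t) →
    Adj G v (p zero) → Adj G v (p (suc zero)) → Adj G v (p (suc (suc zero))) →
    HasInducedDiamond G
  hasInducedDiamond-fan {v = v} {p} ((p-inj , p-edge) , p-induced) v∉p v~p₀ v~p₁ v~p₂ =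
    v , p (suc zero) , p zero , p (suc (suc zero)) ,
    v∉p _ , v∉p _ , v∉p _ , p-distinct (λ ()) , p-distinct (λ ()) , p-distinct (λ ()) ,
    v~p₁ , v~p₀ , sym G (p-edge zero (suc zero) refl) ,
    sym G v~p₂ , sym G (p-edge (suc zero) (suc (suc zero)) refl) , p₂≁p₀
    where
    p-distinct : ∀ {s t} → s ≢ t → p s ≢ p t
    p-distinct s≢t = s≢t ∘ p-inj

    p₂≁p₀ : ¬ Adj G (p (suc (suc zero))) (p zero)
    p₂≁p₀ adj with p-induced (suc (suc zero)) zero adj
    ... | inj₁ ()
    ... | inj₂ ()

  hasInducedHole⊎Diamond-cone : ∀ {k v} {p : Fin (4 + k) → Fin n} →
    IsInducedPath G p → (∀ t → v ≢ p t) →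
    Adj G v (p zero) → Adj G v (p (fromℕ (3 + k))) →
    HasInducedHole G ⊎ HasInducedDiamond G
  hasInducedHole⊎Diamond-cone {v = v} {p} p-ind v∉p v~p₀ v~pₗ
    with dec G v (p (suc zero)) | dec G v (p (suc (suc zero)))
  ... | no v≁p₁  | _        = inj₁ (hasInducedHole-gap p-ind v∉p v~p₀ v≁p₁ v~pₗ)
  ... | yes v~p₁ | no v≁p₂  =
    inj₁ (hasInducedHole-gap (isInducedPath-shift 1 suc (λ _ → refl) p-ind) (v∉p ∘ suc) v~p₁ v≁p₂ v~pₗ)
  ... | yes v~p₁ | yes v~p₂ = inj₂ (hasInducedDiamond-fan p-ind v∉p v~p₀ v~p₁ v~p₂)

mainTheorem4 : ∀ {n} (G : Graph n) (m : ℕ) (v : Fin n) (p : Fin m → Fin n) →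
    IsCycle G (v ∷ p) → 5 ≤ suc m → IsInducedPath G p →
    HasInducedHole G ⊎ HasInducedDiamond G
mainTheorem4 G (suc (suc (suc (suc k)))) v p (_ , c-inj , c-edge) (s≤s (s≤s (s≤s (s≤s (s≤s _))))) p-ind =
  hasInducedHole⊎Diamond-cone G p-ind v∉p v~p₀ v~pₗ
  where
  v∉p : ∀ t → v ≢ p t
  v∉p t eq with c-inj {zero} {suc t} eq
  ... | ()

  v~p₀ : Adj G v (p zero)
  v~p₀ = c-edge zero (suc zero) (inj₁ refl)

  v~pₗ : Adj G v (p (fromℕ (3 + k)))
  v~pₗ = sym G (c-edge (suc (fromℕ (3 + k))) zero (inj₂ (cong (2 +_) (toℕ-fromℕ (3 + k)) , refl)))
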